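{- Let $p$ and $q$ be distinct odd primes, and let $N_0$ be the number of positive integers that cannot be expressed as $px+qy$ with $x,y$ non-negative integers. Then the number of solutions $(x,y,z)$ in non-negative integers of $$px+qy+z=\frac{p(q-1)}{2}+\frac{q(p-1)}{2}$$ equals $\frac{p(q-1)}{2}+\frac{q(p-1)}{2}+1-N_0$. -}

module Defs where

open import Data.Nat using (ℕ; _+_; _*_; _∸_; _/_; _<_; _≡ᵇ_)
open import Data.Product using (_×_; ∃; ∃-syntax)
open import Relation.Binary.PropositionalEquality using (_≡_)
open import Relation.Nullary using (¬_)

Representable : ℕ → ℕ → ℕ → Set
Representable p q n = ∃[ x ] ∃[ y ] p * x + q * y ≡ n

Gap : ℕ → ℕ → ℕ → Set
Gap p q n = 0 < n × ¬ Representable p q n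

S : ℕ → ℕ → ℕ
S p q = (p * (q ∸ 1)) / 2 + (q * (p ∸ 1)) / 2

Sol : ℕ → ℕ → ℕ × ℕ × ℕ → Set
Sol p q (x Data.Product., y Data.Product., z) = p * x + q * y + z ≡ S p q

{-# OPTIONS --safe #-}
-- The map (x , y , z) ↦ p x + q y sends the solutions injectively onto the representable
-- numbers in [0, S]: two representations of a number below p q coincide because p and q are
-- coprime, and S < p q.  By Sylvester's bound every gap is at most p q − p − q ≤ S, so [0, S]
-- splits into the images of the solutions and the N₀ gaps, and the count is S + 1 − N₀.
module Submission where

open import Defs
open import Data.Nat using (ℕ; suc; zero; _+_; _∸_; _*_; _/_; _%_; _<_; _≤_; _≟_; _≤?_; NonZero; >-nonZero; >-nonZero⁻¹; z≤n; s≤s; s≤s⁻¹)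
open import Data.Nat.Properties
open import Data.Nat.DivMod using (m≡m%n+[m/n]*n; %-distribˡ-*; m%n%n≡m%n; [m+kn]%n≡m%n; m%n<n; m/n*n≤m)
open import Data.Nat.Divisibility using (_∣_; divides; ∣⇒≤; ∣m+n∣m⇒∣n; m∣m*n)
open import Data.Nat.Coprimality using (Coprime; coprime-Bézout; coprime-divisor; prime⇒coprime)
import Data.Nat.Coprimality as Coprimality
open import Data.Nat.GCD using (module Bézout)
open import Data.Nat.Primality using (Prime; prime⇒nonZero)
open import Data.Nat.Solver using (module +-*-Solver)
open import Data.Product using (_×_; _,_; proj₁; proj₂)
open import Data.Sum using (_⊎_; inj₁; inj₂; [_,_]′)
open import Data.List using (List; []; _∷_; length; map; _++_; upTo)
open import Data.List.Membership.Propositional using (_∈_)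
open import Data.List.Membership.Propositional.Properties using (∈-map⁺; ∈-map⁻; ∈-++⁺ˡ; ∈-++⁺ʳ; ∈-++⁻; ∈-upTo⁺; ∈-upTo⁻)
open import Data.List.Membership.Propositional.Properties.WithK using (unique∧set⇒bag)
open import Data.List.Membership.DecPropositional _≟_ using (_∈?_)
open import Data.List.Properties using (length-++; length-map; length-upTo)
open import Data.List.Relation.Binary.BagAndSetEquality using (∼bag⇒↭)
open import Data.List.Relation.Binary.Disjoint.Propositional using (Disjoint)
open import Data.List.Relation.Binary.Permutation.Propositional.Properties using (↭-length)
open import Data.List.Relation.Unary.All using (All; []; _∷_)
import Data.List.Relation.Unary.All as All
open import Data.List.Relation.Unary.AllPairs using ([]; _∷_)
open import Data.List.Relation.Unary.Unique.Propositional using (Unique)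
import Data.List.Relation.Unary.Unique.Propositional.Properties as Unique
open import Function.Base using (_∘_)
open import Function.Bundles using (_⇔_; mk⇔; module Equivalence)
open import Relation.Binary.Definitions using (tri<; tri≈; tri>)
open import Relation.Binary.PropositionalEquality using (_≡_; _≢_; refl; sym; trans; cong; cong₂; subst; subst₂; module ≡-Reasoning)
open import Relation.Nullary using (¬_; yes; no; contradiction)

open +-*-Solver using (solve; _:+_; _:*_; _:=_; con)
open Equivalence using (to; from)

%≡%⇒∣∸ : ∀ m n d .{{_ : NonZero d}} → m % d ≡ n % d → d ∣ n ∸ m
%≡%⇒∣∸ m n d m≡n = divides (n / d ∸ m / d) (begin
  n ∸ m                                     ≡⟨ cong₂ _∸_ (m≡m%n+[m/n]*n n d) (m≡m%n+[m/n]*n m d) ⟩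
  (n % d + n / d * d) ∸ (m % d + m / d * d) ≡⟨ cong (λ r → (r + n / d * d) ∸ (m % d + m / d * d)) (sym m≡n) ⟩
  (m % d + n / d * d) ∸ (m % d + m / d * d) ≡⟨ [m+n]∸[m+o]≡n∸o (m % d) _ _ ⟩
  n / d * d ∸ m / d * d                     ≡⟨ *-distribʳ-∸ d (n / d) (m / d) ⟨
  (n / d ∸ m / d) * d                       ∎)
  where open ≡-Reasoning

[m*[n%d]]%d≡[m*n]%d : ∀ m n d .{{_ : NonZero d}} → (m * (n % d)) % d ≡ (m * n) % d
[m*[n%d]]%d≡[m*n]%d m n d = begin
  (m * (n % d)) % d           ≡⟨ %-distribˡ-* m (n % d) d ⟩
  ((m % d) * (n % d % d)) % d ≡⟨ cong (λ r → ((m % d) * r) % d) (m%n%n≡m%n n d) ⟩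
  ((m % d) * (n % d)) % d     ≡⟨ %-distribˡ-* m n d ⟨
  (m * n) % d                 ∎
  where open ≡-Reasoning

m∣n∧n<m⇒n≡0 : ∀ {m n} → m ∣ n → n < m → n ≡ 0
m∣n∧n<m⇒n≡0 {n = zero}  _   _   = refl
m∣n∧n<m⇒n≡0 {n = suc _} m∣n n<m = contradiction (∣⇒≤ m∣n) (<⇒≱ n<m)

Representable-comm : ∀ {p q n} → Representable q p n → Representable p q n
Representable-comm {p} {q} (x , y , qx+py≡n) = y , x , trans (+-comm (p * y) (q * x)) qx+py≡n

representable-of-residue : ∀ {p q n y} .{{_ : NonZero p}} →
  y < p → (q * y) % p ≡ n % p → p * q < n + p + q → Representable p q n
representable-of-residue {p} {q} {n} {y} y<p qy≡n large with q * y ≤? n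
... | yes qy≤n = witness (%≡%⇒∣∸ (q * y) n p qy≡n)
  where
  open ≡-Reasoning
  witness : p ∣ n ∸ q * y → Representable p q n
  witness (divides x n∸qy≡xp) = x , y , (begin
    p * x + q * y     ≡⟨ cong (_+ q * y) (trans (*-comm p x) (sym n∸qy≡xp)) ⟩
    n ∸ q * y + q * y ≡⟨ m∸n+n≡m qy≤n ⟩
    n                 ∎)
... | no qy≰n = contradiction large (≤⇒≯ n+p+q≤pq)
  where
  open ≤-Reasoning
  n<qy : n < q * y
  n<qy = ≰⇒> qy≰n
  p≤qy∸n : p ≤ q * y ∸ n
  p≤qy∸n = ∣⇒≤ {{>-nonZero (m<n⇒0<n∸m n<qy)}} (%≡%⇒∣∸ n (q * y) p (sym qy≡n))
  n+p+q≤pq : n + p + q ≤ p * q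
  n+p+q≤pq = begin
    n + p + q           ≤⟨ +-monoˡ-≤ q (+-monoʳ-≤ n p≤qy∸n) ⟩
    n + (q * y ∸ n) + q ≡⟨ cong (_+ q) (m+[n∸m]≡n (<⇒≤ n<qy)) ⟩
    q * y + q           ≡⟨ trans (+-comm (q * y) q) (sym (*-suc q y)) ⟩
    q * suc y           ≤⟨ *-monoʳ-≤ q y<p ⟩
    q * p               ≡⟨ *-comm q p ⟩
    p * q               ∎

representable-of-inverse : ∀ {p q n} y₀ .{{_ : NonZero p}} →
  (q * y₀) % p ≡ 1 % p → p * q < n + p + q → Representable p q n
representable-of-inverse {p} {q} {n} y₀ qy₀≡1 = representable-of-residue (m%n<n (n * y₀) p) (begin
  (q * ((n * y₀) % p)) % p ≡⟨ [m*[n%d]]%d≡[m*n]%d q (n * y₀) p ⟩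
  (q * (n * y₀)) % p       ≡⟨ cong (_% p) (solve 3 (λ q n y₀ → q :* (n :* y₀) := n :* (q :* y₀)) refl q n y₀) ⟩
  (n * (q * y₀)) % p       ≡⟨ [m*[n%d]]%d≡[m*n]%d n (q * y₀) p ⟨
  (n * ((q * y₀) % p)) % p ≡⟨ cong (λ r → (n * r) % p) qy₀≡1 ⟩
  (n * (1 % p)) % p        ≡⟨ [m*[n%d]]%d≡[m*n]%d n 1 p ⟩
  (n * 1) % p              ≡⟨ cong (_% p) (*-identityʳ n) ⟩
  n % p                    ∎)
  where open ≡-Reasoning

inverse-of-Bézout : ∀ {p q} x y .{{_ : NonZero p}} → 1 + x * p ≡ y * q → (q * y) % p ≡ 1 % p
inverse-of-Bézout {p} {q} x y eq =
  trans (cong (_% p) (trans (*-comm q y) (sym eq))) ([m+kn]%n≡m%n 1 x p)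

representable-above-Frobenius : ∀ {p q n} .{{_ : NonZero p}} .{{_ : NonZero q}} →
  Coprime p q → p * q < n + p + q → Representable p q n
representable-above-Frobenius {p} {q} {n} p⊥q large with coprime-Bézout p⊥q
... | Bézout.Identity.-+ x y eq = representable-of-inverse y (inverse-of-Bézout x y eq) large
... | Bézout.Identity.+- x y eq = Representable-comm {p} {q} (representable-of-inverse x (inverse-of-Bézout y x eq)
                                    (subst₂ _<_ (*-comm p q) (solve 3 (λ n p q → n :+ p :+ q := n :+ q :+ p) refl n p q) large))

small-representation-unique : ∀ {p q x y x′ y′} .{{_ : NonZero q}} → Coprime p q →
  p * x + q * y ≡ p * x′ + q * y′ → p * x + q * y < p * q → x ≡ x′ × y ≡ y′
small-representation-unique {p} {q} {x} {y} {x′} {y′} p⊥q eq small =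
  x≡x′ , *-cancelˡ-≡ y y′ q (+-cancelˡ-≡ (p * x) _ _ (trans eq (cong (λ r → p * r + q * y′) (sym x≡x′))))
  where
  first-unique : ∀ {x y x′ y′} → p * x + q * y ≡ p * x′ + q * y′ → p * x + q * y < p * q →
                 x ≤ x′ → x ≡ x′
  first-unique {x} {y} {x′} {y′} eq small x≤x′ =
    trans (sym (+-identityʳ x)) (subst (λ e → x + e ≡ x′) d≡0 (m+[n∸m]≡n x≤x′))
    where
    d : ℕ
    d = x′ ∸ x
    qy≡pd+qy′ : q * y ≡ p * d + q * y′
    qy≡pd+qy′ = +-cancelˡ-≡ (p * x) _ _ (begin
      p * x + q * y        ≡⟨ eq ⟩
      p * x′ + q * y′      ≡⟨ cong (λ r → p * r + q * y′) (m+[n∸m]≡n x≤x′) ⟨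
      p * (x + d) + q * y′ ≡⟨ solve 5 (λ p x d q y′ → p :* (x :+ d) :+ q :* y′ := p :* x :+ (p :* d :+ q :* y′)) refl p x d q y′ ⟩
      p * x + (p * d + q * y′) ∎)
      where open ≡-Reasoning
    q∣d : q ∣ d
    q∣d = coprime-divisor (Coprimality.sym p⊥q)
            (∣m+n∣m⇒∣n (divides y (trans (+-comm (q * y′) (p * d)) (trans (sym qy≡pd+qy′) (*-comm q y))))
                       (m∣m*n y′))
    d<q : d < q
    d<q = *-cancelˡ-< p d q (begin-strict
      p * d           ≤⟨ *-monoʳ-≤ p (m∸n≤m x′ x) ⟩
      p * x′          ≤⟨ m≤m+n (p * x′) (q * y′) ⟩
      p * x′ + q * y′ ≡⟨ eq ⟨
      p * x + q * y   <⟨ small ⟩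
      p * q           ∎)
      where open ≤-Reasoning
    d≡0 : d ≡ 0
    d≡0 = m∣n∧n<m⇒n≡0 q∣d d<q
  x≡x′ : x ≡ x′
  x≡x′ with ≤-total x x′
  ... | inj₁ x≤x′ = first-unique eq small x≤x′
  ... | inj₂ x′≤x = sym (first-unique (sym eq) (subst (_< p * q) eq small) x′≤x)

m*[n∸1]+m≡m*n : ∀ m n .{{_ : NonZero n}} → m * (n ∸ 1) + m ≡ m * n
m*[n∸1]+m≡m*n m n = begin
  m * (n ∸ 1) + m     ≡⟨ cong (m * (n ∸ 1) +_) (*-identityʳ m) ⟨
  m * (n ∸ 1) + m * 1 ≡⟨ *-distribˡ-+ m (n ∸ 1) 1 ⟨
  m * (n ∸ 1 + 1)     ≡⟨ cong (m *_) (m∸n+n≡m (>-nonZero⁻¹ n)) ⟩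
  m * n               ∎
  where open ≡-Reasoning

m≤[m/2]*2+1 : ∀ m → m ≤ m / 2 * 2 + 1
m≤[m/2]*2+1 m = begin
  m                 ≡⟨ m≡m%n+[m/n]*n m 2 ⟩
  m % 2 + m / 2 * 2 ≤⟨ +-monoˡ-≤ (m / 2 * 2) (m<1+n⇒m≤n (m%n<n m 2)) ⟩
  1 + m / 2 * 2     ≡⟨ +-comm 1 (m / 2 * 2) ⟩
  m / 2 * 2 + 1     ∎
  where open ≤-Reasoning

module _ (p q : ℕ) .{{_ : NonZero p}} .{{_ : NonZero q}} where

  private
    A B : ℕ
    A = p * (q ∸ 1)
    B = q * (p ∸ 1)

    A+B+[p+q]≡p*q*2 : A + B + (p + q) ≡ p * q * 2
    A+B+[p+q]≡p*q*2 = begin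
      A + B + (p + q)   ≡⟨ solve 4 (λ A B p q → A :+ B :+ (p :+ q) := (A :+ p) :+ (B :+ q)) refl A B p q ⟩
      (A + p) + (B + q) ≡⟨ cong₂ _+_ (m*[n∸1]+m≡m*n p q) (trans (m*[n∸1]+m≡m*n q p) (*-comm q p)) ⟩
      p * q + p * q     ≡⟨ solve 1 (λ r → r :+ r := r :* con 2) refl (p * q) ⟩
      p * q * 2         ∎
      where open ≡-Reasoning

    0<p+q : 0 < p + q
    0<p+q = <-≤-trans (>-nonZero⁻¹ p) (m≤m+n p q)

  S<p*q : S p q < p * q
  S<p*q = *-cancelʳ-< 2 (S p q) (p * q) (begin-strict
    (A / 2 + B / 2) * 2   ≡⟨ *-distribʳ-+ 2 (A / 2) (B / 2) ⟩
    A / 2 * 2 + B / 2 * 2 ≤⟨ +-mono-≤ (m/n*n≤m A 2) (m/n*n≤m B 2) ⟩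
    A + B                 <⟨ m<m+n (A + B) 0<p+q ⟩
    A + B + (p + q)       ≡⟨ A+B+[p+q]≡p*q*2 ⟩
    p * q * 2             ∎)
    where open ≤-Reasoning

  n+p+q≤p*q⇒n≤S : ∀ {n} → n + p + q ≤ p * q → n ≤ S p q
  n+p+q≤p*q⇒n≤S {n} n+p+q≤pq = *-cancelʳ-≤ n (S p q) 2 (+-cancelʳ-≤ (p + q + (p + q)) (n * 2) (S p q * 2) (begin
    n * 2 + (p + q + (p + q))                   ≡⟨ solve 3 (λ n p q → n :* con 2 :+ (p :+ q :+ (p :+ q)) := (n :+ p :+ q) :* con 2) refl n p q ⟩
    (n + p + q) * 2                             ≤⟨ *-monoˡ-≤ 2 n+p+q≤pq ⟩
    p * q * 2                                   ≡⟨ A+B+[p+q]≡p*q*2 ⟨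
    A + B + (p + q)                             ≤⟨ +-monoˡ-≤ (p + q) (+-mono-≤ (m≤[m/2]*2+1 A) (m≤[m/2]*2+1 B)) ⟩
    (A / 2 * 2 + 1) + (B / 2 * 2 + 1) + (p + q) ≡⟨ solve 4 (λ a b p q → (a :* con 2 :+ con 1) :+ (b :* con 2 :+ con 1) :+ (p :+ q) := (a :+ b) :* con 2 :+ (con 2 :+ (p :+ q))) refl (A / 2) (B / 2) p q ⟩
    S p q * 2 + (2 + (p + q))                   ≤⟨ +-monoʳ-≤ (S p q * 2) (+-monoˡ-≤ (p + q) (+-mono-≤ (>-nonZero⁻¹ p) (>-nonZero⁻¹ q))) ⟩
    S p q * 2 + (p + q + (p + q))               ∎))
    where open ≤-Reasoning

map⁺-injectiveOn : ∀ {A B : Set} {P : A → Set} (f : A → B) →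
  (∀ {a b} → P a → P b → f a ≡ f b → a ≡ b) →
  ∀ {xs} → All P xs → Unique xs → Unique (map f xs)
map⁺-injectiveOn f inj {[]}     []         []         = []
map⁺-injectiveOn f inj {x ∷ xs} (px ∷ pxs) (x∉ ∷ uxs) = distinct pxs x∉ ∷ map⁺-injectiveOn f inj pxs uxs
  where
  distinct : ∀ {ys} → All _ ys → All (x ≢_) ys → All (f x ≢_) (map f ys)
  distinct []         []           = []
  distinct (py ∷ pys) (x≢y ∷ x≢ys) = (x≢y ∘ inj px py) ∷ distinct pys x≢ys

length-partitions-upTo : ∀ {xs ys : List ℕ} {m} → Unique xs → Unique ys → Disjoint xs ys →
  (∀ {n} → (n ∈ xs ⊎ n ∈ ys) ⇔ n < m) → length xs + length ys ≡ m
length-partitions-upTo {xs} {ys} {m} uxs uys disjoint partition = begin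
  length xs + length ys ≡⟨ length-++ xs ⟨
  length (xs ++ ys)     ≡⟨ ↭-length (∼bag⇒↭ (unique∧set⇒bag (Unique.++⁺ uxs uys disjoint) (Unique.upTo⁺ m) xs++ys∼upTo)) ⟩
  length (upTo m)       ≡⟨ length-upTo m ⟩
  m                     ∎
  where
  open ≡-Reasoning
  xs++ys∼upTo : ∀ {n} → n ∈ xs ++ ys ⇔ n ∈ upTo m
  xs++ys∼upTo = mk⇔ (∈-upTo⁺ ∘ to partition ∘ ∈-++⁻ xs) ([ ∈-++⁺ˡ , ∈-++⁺ʳ xs ]′ ∘ from partition ∘ ∈-upTo⁻)

coprime-if-distinct-primes : ∀ {p q} → Prime p → Prime q → p ≢ q → Coprime p q
coprime-if-distinct-primes {p} {q} p-prime q-prime p≢q with <-cmp p q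
... | tri< p<q _ _ = Coprimality.sym (prime⇒coprime q-prime {{prime⇒nonZero p-prime}} p<q)
... | tri≈ _ p≡q _ = contradiction p≡q p≢q
... | tri> _ _ q<p = prime⇒coprime p-prime {{prime⇒nonZero q-prime}} q<p

weight : ℕ → ℕ → ℕ × ℕ × ℕ → ℕ
weight p q (x , y , _) = p * x + q * y

Sol⇒weight≤S : ∀ {p q t} → Sol p q t → weight p q t ≤ S p q
Sol⇒weight≤S {p} {q} {x , y , z} sol = subst (p * x + q * y ≤_) sol (m≤m+n (p * x + q * y) z)

weight-injectiveOn-Sol : ∀ {p q} .{{_ : NonZero p}} .{{_ : NonZero q}} → Coprime p q →
  ∀ {t t′} → Sol p q t → Sol p q t′ → weight p q t ≡ weight p q t′ → t ≡ t′
weight-injectiveOn-Sol {p} {q} p⊥q {x , y , z} {x′ , y′ , z′} sol sol′ eq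
  with refl , refl ← small-representation-unique p⊥q eq (≤-<-trans (Sol⇒weight≤S {p} {q} sol) (S<p*q p q))
  = cong (λ z → x , y , z) (+-cancelˡ-≡ (p * x + q * y) z z′ (trans sol (sym sol′)))

∈-map-weight⇔ : ∀ {p q T} → (∀ t → t ∈ T ⇔ Sol p q t) →
  ∀ {n} → n ∈ map (weight p q) T ⇔ (Representable p q n × n ≤ S p q)
∈-map-weight⇔ {p} {q} {T} memT = mk⇔ ∈⇒ ⇒∈
  where
  ∈⇒ : ∀ {n} → n ∈ map (weight p q) T → Representable p q n × n ≤ S p q
  ∈⇒ n∈ with (x , y , z) , t∈T , refl ← ∈-map⁻ (weight p q) n∈ =
    (x , y , refl) , Sol⇒weight≤S {p} {q} (to (memT _) t∈T)
  ⇒∈ : ∀ {n} → Representable p q n × n ≤ S p q → n ∈ map (weight p q) T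
  ⇒∈ ((x , y , refl) , n≤S) = ∈-map⁺ (weight p q) (from (memT (x , y , S p q ∸ (p * x + q * y))) (m+[n∸m]≡n n≤S))

length-Sol+length-Gap : ∀ {p q} .{{_ : NonZero p}} .{{_ : NonZero q}} → Coprime p q →
  ∀ {G} → Unique G → (∀ n → n ∈ G ⇔ Gap p q n) →
  ∀ {T} → Unique T → (∀ t → t ∈ T ⇔ Sol p q t) →
  length T + length G ≡ suc (S p q)
length-Sol+length-Gap {p} {q} p⊥q {G} uG memG {T} uT memT = begin
  length T + length G ≡⟨ cong (_+ length G) (length-map (weight p q) T) ⟨
  length W + length G ≡⟨ length-partitions-upTo uW uG disjoint partition ⟩
  suc (S p q)         ∎
  where
  open ≡-Reasoning
  W : List ℕ
  W = map (weight p q) T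
  memW : ∀ {n} → n ∈ W ⇔ (Representable p q n × n ≤ S p q)
  memW = ∈-map-weight⇔ {p} {q} memT
  uW : Unique W
  uW = map⁺-injectiveOn (weight p q) (weight-injectiveOn-Sol p⊥q) (All.tabulate (to (memT _))) uT
  disjoint : Disjoint W G
  disjoint (n∈W , n∈G) = proj₂ (to (memG _) n∈G) (proj₁ (to memW n∈W))
  gap≤S : ∀ {n} → Gap p q n → n ≤ S p q
  gap≤S (_ , unrepresentable) = n+p+q≤p*q⇒n≤S p q (≮⇒≥ (unrepresentable ∘ representable-above-Frobenius p⊥q))
  W-or-G : ∀ {n} → n ≤ S p q → n ∈ W ⊎ n ∈ G
  W-or-G {zero}  _ = inj₁ (from memW ((0 , 0 , cong₂ _+_ (*-zeroʳ p) (*-zeroʳ q)) , z≤n))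
  W-or-G {suc n} n≤S with suc n ∈? W
  ... | yes n∈W = inj₁ n∈W
  ... | no  n∉W = inj₂ (from (memG _) (s≤s z≤n , λ rep → n∉W (from memW (rep , n≤S))))
  partition : ∀ {n} → (n ∈ W ⊎ n ∈ G) ⇔ n < suc (S p q)
  partition = mk⇔ (s≤s ∘ [ proj₂ ∘ to memW , gap≤S ∘ to (memG _) ]′) (W-or-G ∘ s≤s⁻¹)

lemma8 : (p q : ℕ) → Prime p → Prime q → ¬ 2 ∣ p → ¬ 2 ∣ q → p ≢ q →
         (G : List ℕ) → Unique G → (∀ n → n ∈ G ⇔ Gap p q n) →
         (T : List (ℕ × ℕ × ℕ)) → Unique T → (∀ t → t ∈ T ⇔ Sol p q t) →
         length T ≡ S p q + 1 ∸ length G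
lemma8 p q p-prime q-prime _ _ p≢q G uG memG T uT memT = begin
  length T                       ≡⟨ m+n∸n≡m (length T) (length G) ⟨
  length T + length G ∸ length G ≡⟨ cong (_∸ length G) count ⟩
  suc (S p q) ∸ length G         ≡⟨ cong (_∸ length G) (+-comm 1 (S p q)) ⟩
  S p q + 1 ∸ length G           ∎
  where
  open ≡-Reasoning
  count : length T + length G ≡ suc (S p q)
  count = length-Sol+length-Gap {{prime⇒nonZero p-prime}} {{prime⇒nonZero q-prime}}
            (coprime-if-distinct-primes p-prime q-prime p≢q) uG memG uT memT
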